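{- Let $M_1$ and $M_2$ be matroids on disjoint ground sets. Then the foundation of the direct sum $M_1\oplus M_2$ is isomorphic to $F(M_1)\otimes F(M_2)$.
   Context: A pasture is a commutative monoid $P$ with absorbing element $0$, $P^\times=P\setminus\{0\}$, and a nullset $N_P$ of formal sums $a+b+c$ ($a,b,c\in P$) such that: $a+0+0\in N_P$ iff $a=0$; $N_P$ is closed under multiplying all terms by any $d\in P$; there is a unique $\epsilon\in P^\times$ with $1+\epsilon+0\in N_P$. Morphisms are multiplicative maps preserving $0$, $1$ and null sums. For a matroid $N$ on $E$ with hyperplanes $\mathcal H$ and a pasture $P$, a $P$-representation is a family $f_H:E\to P$ ($H\in\mathcal H$) with $f_H(e)=0$ iff $e\in H$ such that for each modular triple of hyperplanes $(H_1,H_2,H_3)$ (i.e. $H_1\cap H_2\cap H_3$ is a corank-2 flat equal to each pairwise intersection) there are $c_1,c_2,c_3\in P$ not all $0$ with $\sum_i c_if_{H_i}(e)\in N_P$ for all $e$. Two representations are rescaling equivalent if $f'_H(e)=c_Hc_ef_H(e)$ with $c_H,c_e\in P^\times$. The foundation $F(N)$ is the pasture with $\mathrm{Hom}(F(N),P)$ naturally (in $P$) in bijection with rescaling classes of $P$-representations of $N$. $A\otimes B$ denotes the (absolute) tensor product of pastures, i.e. their coproduct in the category of pastures. -}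

module Defs where

open import Level using (Level)
open import Data.Nat using (ℕ; zero; suc; _+_; _≤_; _<_)
open import Data.Fin using (Fin)
open import Data.Fin.Subset using (Subset; _∉_; _⊆_; ⁅_⁆; ⊤; _∩_; _∪_; ∣_∣)
open import Data.Vec using (take; drop)
open import Data.Product using (Σ; ∃; _×_; _,_)
open import Relation.Binary.PropositionalEquality using (_≡_; _≢_)
open import Relation.Nullary using (¬_)
open import Function.Bundles using (_⇔_)

record Matroid (n : ℕ) : Set where
  field
    rank        : Subset n → ℕ
    rank-bound  : ∀ X → rank X ≤ ∣ X ∣
    rank-mono   : ∀ {X Y} → X ⊆ Y → rank X ≤ rank Y
    rank-submod : ∀ X Y → rank (X ∪ Y) + rank (X ∩ Y) ≤ rank X + rank Y

module _ {n : ℕ} (M : Matroid n) where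
  open Matroid M

  IsFlat : Subset n → Set
  IsFlat X = ∀ e → e ∉ X → rank X < rank (X ∪ ⁅ e ⁆)

  IsHyperplane : Subset n → Set
  IsHyperplane H = IsFlat H × (suc (rank H) ≡ rank ⊤)

  IsCorank2Flat : Subset n → Set
  IsCorank2Flat X = IsFlat X × (2 + rank X ≡ rank ⊤)

  IsModularTriple : Subset n → Subset n → Subset n → Set
  IsModularTriple H₁ H₂ H₃ =
    IsHyperplane H₁ × IsHyperplane H₂ × IsHyperplane H₃ ×
    IsCorank2Flat (H₁ ∩ H₂ ∩ H₃) ×
    (H₁ ∩ H₂ ≡ H₁ ∩ H₂ ∩ H₃) × (H₁ ∩ H₃ ≡ H₁ ∩ H₂ ∩ H₃) × (H₂ ∩ H₃ ≡ H₁ ∩ H₂ ∩ H₃)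

-- M is the direct sum M₁ ⊕ M₂ (ground set Fin n₁ ⊎ Fin n₂ ≅ Fin (n₁ + n₂),
-- the first n₁ elements belonging to M₁, the remaining n₂ to M₂).
IsDirectSum : ∀ {n₁ n₂} → Matroid n₁ → Matroid n₂ → Matroid (n₁ + n₂) → Set
IsDirectSum {n₁} M₁ M₂ M =
  ∀ X → Matroid.rank M X ≡ Matroid.rank M₁ (take n₁ X) + Matroid.rank M₂ (drop n₁ X)

record Pasture : Set₁ where
  infixl 7 _·_
  field
    Carrier    : Set
    _·_        : Carrier → Carrier → Carrier
    one        : Carrier
    0#         : Carrier
    ·-assoc    : ∀ x y z → (x · y) · z ≡ x · (y · z)
    ·-comm     : ∀ x y → x · y ≡ y · x
    ·-identity : ∀ x → one · x ≡ x
    ·-zero     : ∀ x → 0# · x ≡ 0#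
    ·-inverse  : ∀ x → x ≢ 0# → ∃ λ y → x · y ≡ one
    -- nullset: a set of formal sums a + b + c (unordered: closed under permutations)
    Null       : Carrier → Carrier → Carrier → Set
    Null-swap  : ∀ a b c → Null a b c → Null b a c
    Null-rot   : ∀ a b c → Null a b c → Null b c a
    Null-single : ∀ a → Null a 0# 0# ⇔ (a ≡ 0#)
    Null-scale : ∀ d a b c → Null a b c → Null (d · a) (d · b) (d · c)
    ε          : Carrier
    ε≢0        : ε ≢ 0#
    Null-ε     : Null one ε 0#
    ε-unique   : ∀ x → x ≢ 0# → Null one x 0# → x ≡ ε

open Pasture

record Hom (P Q : Pasture) : Set where
  field
    fun       : Carrier P → Carrier Q
    pres-·    : ∀ x y → fun (_·_ P x y) ≡ _·_ Q (fun x) (fun y)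
    pres-one  : fun (one P) ≡ one Q
    pres-0    : fun (0# P) ≡ 0# Q
    pres-Null : ∀ a b c → Null P a b c → Null Q (fun a) (fun b) (fun c)

open Hom

idHom : (P : Pasture) → Hom P P
idHom P = record
  { fun = λ x → x ; pres-· = λ _ _ → Relation.Binary.PropositionalEquality.refl
  ; pres-one = Relation.Binary.PropositionalEquality.refl
  ; pres-0 = Relation.Binary.PropositionalEquality.refl
  ; pres-Null = λ _ _ _ p → p }

_∘H_ : ∀ {P Q R} → Hom Q R → Hom P Q → Hom P R
_∘H_ {P} {Q} {R} g f = record
  { fun = λ x → fun g (fun f x)
  ; pres-· = λ x y → Relation.Binary.PropositionalEquality.trans
      (Relation.Binary.PropositionalEquality.cong (fun g) (pres-· f x y)) (pres-· g _ _)
  ; pres-one = Relation.Binary.PropositionalEquality.trans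
      (Relation.Binary.PropositionalEquality.cong (fun g) (pres-one f)) (pres-one g)
  ; pres-0 = Relation.Binary.PropositionalEquality.trans
      (Relation.Binary.PropositionalEquality.cong (fun g) (pres-0 f)) (pres-0 g)
  ; pres-Null = λ a b c p → pres-Null g _ _ _ (pres-Null f a b c p) }

_≈H_ : ∀ {P Q} → Hom P Q → Hom P Q → Set
f ≈H g = ∀ x → fun f x ≡ fun g x

record _≅_ (P Q : Pasture) : Set where
  field
    to      : Hom P Q
    from    : Hom Q P
    from∘to : (from ∘H to) ≈H idHom P
    to∘from : (to ∘H from) ≈H idHom Q

-- (ι₁ , ι₂) exhibits T as the coproduct A ⊗ B in the category of pastures
record IsCoproduct {A B T : Pasture} (ι₁ : Hom A T) (ι₂ : Hom B T) : Set₁ where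
  field
    copair     : ∀ {P} → Hom A P → Hom B P → Hom T P
    copair-ι₁  : ∀ {P} (f : Hom A P) (g : Hom B P) → (copair f g ∘H ι₁) ≈H f
    copair-ι₂  : ∀ {P} (f : Hom A P) (g : Hom B P) → (copair f g ∘H ι₂) ≈H g
    copair-unique : ∀ {P} (h h' : Hom T P) →
      (h ∘H ι₁) ≈H (h' ∘H ι₁) → (h ∘H ι₂) ≈H (h' ∘H ι₂) → h ≈H h'

-- a family (f_H)_H, indexed by subsets; only the values at hyperplanes matter
Family : ℕ → Pasture → Set
Family n P = Subset n → Fin n → Carrier P

record Rep {n : ℕ} (M : Matroid n) (P : Pasture) : Set where
  field
    f        : Family n P
    zero-iff : ∀ H → IsHyperplane M H → ∀ e → (f H e ≡ 0# P) ⇔ (e Data.Fin.Subset.∈ H)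
    modular  : ∀ H₁ H₂ H₃ → IsModularTriple M H₁ H₂ H₃ →
      Σ (Carrier P) λ c₁ → Σ (Carrier P) λ c₂ → Σ (Carrier P) λ c₃ →
        ¬ (c₁ ≡ 0# P × c₂ ≡ 0# P × c₃ ≡ 0# P) ×
        (∀ e → Null P (_·_ P c₁ (f H₁ e)) (_·_ P c₂ (f H₂ e)) (_·_ P c₃ (f H₃ e)))

open Rep

Rescaling : ∀ {n} (M : Matroid n) (P : Pasture) → Family n P → Family n P → Set
Rescaling {n} M P f f' =
  Σ (Subset n → Carrier P) λ cH → Σ (Fin n → Carrier P) λ cE →
    (∀ H → IsHyperplane M H → cH H ≢ 0# P) × (∀ e → cE e ≢ 0# P) ×
    (∀ H → IsHyperplane M H → ∀ e → f' H e ≡ _·_ P (_·_ P (cH H) (cE e)) (f H e))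

pushFamily : ∀ {n P Q} → Hom P Q → Family n P → Family n Q
pushFamily g f H e = fun g (f H e)

-- F is a foundation of M: Hom(F, -) is naturally isomorphic to the functor
-- P ↦ {P-representations of M}/rescaling equivalence.
record IsFoundation {n : ℕ} (M : Matroid n) (F : Pasture) : Set₁ where
  field
    Φ     : (P : Pasture) → Hom F P → Rep M P
    Φ-resp : ∀ P (h h' : Hom F P) → h ≈H h' → Rescaling M P (f (Φ P h)) (f (Φ P h'))
    Φ-inj : ∀ P (h h' : Hom F P) → Rescaling M P (f (Φ P h)) (f (Φ P h')) → h ≈H h'
    Φ-surj : ∀ P (ρ : Rep M P) → Σ (Hom F P) λ h → Rescaling M P (f (Φ P h)) (f ρ)
    Φ-nat : ∀ P Q (g : Hom P Q) (h : Hom F P) →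
      Rescaling M Q (f (Φ Q (g ∘H h))) (pushFamily g (f (Φ P h)))

-- The hyperplanes of M₁ ⊕ M₂ are exactly the sets H₁ ∪ E₂ and E₁ ∪ H₂ for hyperplanes Hᵢ of
-- Mᵢ, and a modular triple never mixes the two kinds.  Hence a P-representation of M₁ ⊕ M₂ is
-- the same as a pair of P-representations of M₁ and M₂: restrict to E₁ resp. E₂, or glue two
-- representations by extending each by zero.  Both operations respect rescaling and commute
-- with push-forward along morphisms.  By the universal properties of the foundations and of the
-- coproduct T = F(M₁) ⊗ F(M₂), the morphism F(M₁ ⊕ M₂) → T classifying the glued universal
-- representations is then inverse to the copairing of the morphisms F(Mᵢ) → F(M₁ ⊕ M₂)
-- classifying the restrictions of the universal representation of M₁ ⊕ M₂.

module Submission where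

open import Defs
open import Data.Nat using (ℕ; zero; suc; _+_; _≤_; _<_; s≤s; _≟_; _<?_)
open import Data.Nat.Properties
  using (+-assoc; +-comm; +-suc; +-cancelˡ-≡; +-cancelʳ-≡; +-cancelʳ-<; +-cancelˡ-<;
         +-monoˡ-<; +-monoʳ-<; +-mono-≤; ≤-trans; ≤-reflexive; <-irrefl; <-≤-trans;
         m≤n⇒m<n∨m≡n)
open import Data.Bool using (Bool; true; false; _∧_; _∨_; if_then_else_)
open import Data.Bool.Properties using (if-float) renaming (_≟_ to _≟ᵇ_)
open import Data.Fin using (Fin; zero; suc; _↑ˡ_; _↑ʳ_; splitAt)
open import Data.Fin.Properties using (all?; splitAt⁻¹-↑ˡ; splitAt⁻¹-↑ʳ)
open import Data.Fin.Subset using (Subset; _∈_; _∉_; ⁅_⁆; ⊤; ⊥; _∩_; _∪_)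
open import Data.Fin.Subset.Properties
  using (∈⊤; ⊆⊤; ⊆-antisym; _∈?_; ∩-comm; ∩-identityˡ; ∩-identityʳ; ∪-identityʳ)
open import Data.Vec using (Vec; _∷_; _++_; take; drop; replicate; lookup)
open import Data.Vec.Properties
  using (++-injectiveˡ; ++-injectiveʳ; take++drop≡id; zipWith-++; lookup-++ˡ; lookup-++ʳ;
         []=⇒lookup; lookup⇒[]=; ≡-dec)
open import Data.Vec.Functional using () renaming (_++_ to _++ᶠ_)
open import Data.Vec.Functional.Properties using () renaming (lookup-++ˡ to lookupᶠ-++ˡ; lookup-++ʳ to lookupᶠ-++ʳ)
open import Data.Product using (Σ; _×_; _,_; proj₁; proj₂)
open import Data.Product.Function.NonDependent.Propositional using (_×-⇔_)
open import Data.Sum using (_⊎_; inj₁; inj₂; [_,_]; [_,_]′)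
open import Data.Sum.Properties using ([,]-∘; [,]-cong)
open import Data.Empty using (⊥-elim)
open import Function using (_∘_)
open import Function.Bundles using (_⇔_; mk⇔; Equivalence)
open import Function.Construct.Composition using (_⇔-∘_)
open import Function.Construct.Symmetry using (⇔-sym)
open import Relation.Binary.PropositionalEquality
open import Relation.Nullary using (¬_; Dec; yes; no; does)
open import Relation.Nullary.Decidable using (¬?; _×-dec_; _→-dec_; dec-true; dec-false)
open import Relation.Binary.Bundles using (Setoid)
import Relation.Binary.Reasoning.Setoid as SetoidReasoning
open import Level using (0ℓ)

open Equivalence using (to; from)

is⊤? : ∀ {n} (B : Subset n) → Dec (B ≡ ⊤)
is⊤? B = ≡-dec _≟ᵇ_ B ⊤

replicate-++ : ∀ {A : Set} m {n} (x : A) → replicate (m + n) x ≡ replicate m x ++ replicate n x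
replicate-++ zero    x = refl
replicate-++ (suc m) x = cong (x ∷_) (replicate-++ m x)

⊤-++ : ∀ m {n} → ⊤ {m + n} ≡ ⊤ {m} ++ ⊤ {n}
⊤-++ m = replicate-++ m true

⁅↑ˡ⁆ : ∀ {m} n (i : Fin m) → ⁅ i ↑ˡ n ⁆ ≡ ⁅ i ⁆ ++ ⊥ {n}
⁅↑ˡ⁆ {suc m} n zero    = cong (true ∷_) (replicate-++ m false)
⁅↑ˡ⁆ {suc m} n (suc i) = cong (false ∷_) (⁅↑ˡ⁆ n i)

⁅↑ʳ⁆ : ∀ m {n} (j : Fin n) → ⁅ m ↑ʳ j ⁆ ≡ ⊥ {m} ++ ⁅ j ⁆
⁅↑ʳ⁆ zero    j = refl
⁅↑ʳ⁆ (suc m) j = cong (false ∷_) (⁅↑ʳ⁆ m j)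

++-∪-⁅↑ˡ⁆ : ∀ {m n} (A : Subset m) (B : Subset n) i → (A ++ B) ∪ ⁅ i ↑ˡ n ⁆ ≡ (A ∪ ⁅ i ⁆) ++ B
++-∪-⁅↑ˡ⁆ {n = n} A B i = begin
  (A ++ B) ∪ ⁅ i ↑ˡ n ⁆     ≡⟨ cong ((A ++ B) ∪_) (⁅↑ˡ⁆ n i) ⟩
  (A ++ B) ∪ (⁅ i ⁆ ++ ⊥)   ≡⟨ zipWith-++ _∨_ A B ⁅ i ⁆ ⊥ ⟩
  (A ∪ ⁅ i ⁆) ++ (B ∪ ⊥)    ≡⟨ cong ((A ∪ ⁅ i ⁆) ++_) (∪-identityʳ B) ⟩
  (A ∪ ⁅ i ⁆) ++ B          ∎
  where open ≡-Reasoning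

++-∪-⁅↑ʳ⁆ : ∀ {m n} (A : Subset m) (B : Subset n) j → (A ++ B) ∪ ⁅ m ↑ʳ j ⁆ ≡ A ++ (B ∪ ⁅ j ⁆)
++-∪-⁅↑ʳ⁆ {m} A B j = begin
  (A ++ B) ∪ ⁅ m ↑ʳ j ⁆     ≡⟨ cong ((A ++ B) ∪_) (⁅↑ʳ⁆ m j) ⟩
  (A ++ B) ∪ (⊥ ++ ⁅ j ⁆)   ≡⟨ zipWith-++ _∨_ A B ⊥ ⁅ j ⁆ ⟩
  (A ∪ ⊥) ++ (B ∪ ⁅ j ⁆)    ≡⟨ cong (_++ (B ∪ ⁅ j ⁆)) (∪-identityʳ A) ⟩
  A ++ (B ∪ ⁅ j ⁆)          ∎
  where open ≡-Reasoning

take-++ : ∀ {A : Set} {m n} (xs : Vec A m) (ys : Vec A n) → take m (xs ++ ys) ≡ xs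
take-++ {m = m} xs ys = ++-injectiveˡ (take m (xs ++ ys)) xs (take++drop≡id m (xs ++ ys))

drop-++ : ∀ {A : Set} {m n} (xs : Vec A m) (ys : Vec A n) → drop m (xs ++ ys) ≡ ys
drop-++ {m = m} xs ys = ++-injectiveʳ (take m (xs ++ ys)) xs (take++drop≡id m (xs ++ ys))

∈-resp-lookup : ∀ {m n} {X : Subset m} {Y : Subset n} {k l} → lookup X k ≡ lookup Y l → l ∈ Y → k ∈ X
∈-resp-lookup {X = X} {k = k} eq l∈Y = lookup⇒[]= k X (trans eq ([]=⇒lookup l∈Y))

↑ˡ∈++⇔∈ : ∀ {m n} (A : Subset m) (B : Subset n) i → (i ↑ˡ n) ∈ A ++ B ⇔ i ∈ A
↑ˡ∈++⇔∈ A B i = mk⇔ (∈-resp-lookup (sym (lookup-++ˡ A B i))) (∈-resp-lookup (lookup-++ˡ A B i))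

↑ʳ∈++⇔∈ : ∀ {m n} (A : Subset m) (B : Subset n) j → (m ↑ʳ j) ∈ A ++ B ⇔ j ∈ B
↑ʳ∈++⇔∈ A B j = mk⇔ (∈-resp-lookup (sym (lookup-++ʳ A B j))) (∈-resp-lookup (lookup-++ʳ A B j))

data SplitView (m n : ℕ) : Fin (m + n) → Set where
  left  : ∀ i → SplitView m n (i ↑ˡ n)
  right : ∀ j → SplitView m n (m ↑ʳ j)

splitView : ∀ m {n} e → SplitView m n e
splitView m e with splitAt m e in eq
... | inj₁ i = subst (SplitView m _) (splitAt⁻¹-↑ˡ eq) (left i)
... | inj₂ j = subst (SplitView m _) (splitAt⁻¹-↑ʳ eq) (right j)

module _ {k : ℕ} (N : Matroid k) where
  open Matroid N

  isFlat? : ∀ X → Dec (IsFlat N X)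
  isFlat? X = all? (λ e → ¬? (e ∈? X) →-dec (rank X <? rank (X ∪ ⁅ e ⁆)))

  isHyperplane? : ∀ H → Dec (IsHyperplane N H)
  isHyperplane? H = isFlat? H ×-dec (suc (rank H) ≟ rank ⊤)

  ⊤-isFlat : IsFlat N ⊤
  ⊤-isFlat e e∉⊤ = ⊥-elim (e∉⊤ ∈⊤)

  flat-of-full-rank≡⊤ : ∀ {X} → IsFlat N X → rank X ≡ rank ⊤ → X ≡ ⊤
  flat-of-full-rank≡⊤ {X} flat full = ⊆-antisym ⊆⊤ (λ {e} _ → member e)
    where
    member : ∀ e → e ∈ X
    member e with e ∈? X
    ... | yes e∈X = e∈X
    ... | no  e∉X = ⊥-elim (<-irrefl refl (<-≤-trans (flat e e∉X)
                      (subst (rank (X ∪ ⁅ e ⁆) ≤_) (sym full) (rank-mono ⊆⊤))))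

  hyperplane≢⊤ : ∀ {H} → IsHyperplane N H → H ≢ ⊤
  hyperplane≢⊤ (_ , corank₁) refl = <-irrefl (sym corank₁) (s≤s (rank-mono ⊆⊤))

suc[m+n]≡o+p-cases : ∀ {m n o p} → m ≤ o → n ≤ p → suc (m + n) ≡ o + p →
                     (suc m ≡ o × n ≡ p) ⊎ (m ≡ o × suc n ≡ p)
suc[m+n]≡o+p-cases {m} {n} m≤o n≤p eq with m≤n⇒m<n∨m≡n m≤o | m≤n⇒m<n∨m≡n n≤p
... | inj₂ refl | _         = inj₂ (refl , +-cancelˡ-≡ m _ _ (trans (+-suc m n) eq))
... | inj₁ _    | inj₂ refl = inj₁ (+-cancelʳ-≡ n _ _ eq , refl)
... | inj₁ m<o  | inj₁ n<p  =
  ⊥-elim (<-irrefl eq (≤-trans (s≤s (≤-reflexive (sym (+-suc m n)))) (+-mono-≤ m<o n<p)))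

module FlatEmbedding {k m : ℕ} (N : Matroid k) (M : Matroid m)
  (lift : Subset k → Subset m) (shift : ℕ)
  (lift-injective : ∀ {A B} → lift A ≡ lift B → A ≡ B)
  (lift-∩ : ∀ A B → lift A ∩ lift B ≡ lift (A ∩ B))
  (lift-⊤ : lift ⊤ ≡ ⊤)
  (rank-lift : ∀ A → Matroid.rank M (lift A) ≡ Matroid.rank N A + shift)
  (flat-lift : ∀ A → IsFlat M (lift A) ⇔ IsFlat N A)
  where

  private
    module N = Matroid N
    module M = Matroid M

  corank-lift : ∀ d A → (d + M.rank (lift A) ≡ M.rank ⊤) ⇔ (d + N.rank A ≡ N.rank ⊤)
  corank-lift d A = mk⇔
    (λ eq → +-cancelʳ-≡ shift _ _ (trans (sym shifted) (trans eq rank-⊤)))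
    (λ eq → trans shifted (trans (cong (_+ shift) eq) (sym rank-⊤)))
    where
    shifted : d + M.rank (lift A) ≡ d + N.rank A + shift
    shifted = trans (cong (d +_) (rank-lift A)) (sym (+-assoc d _ shift))
    rank-⊤ : M.rank ⊤ ≡ N.rank ⊤ + shift
    rank-⊤ = trans (cong M.rank (sym lift-⊤)) (rank-lift ⊤)

  hyperplane-lift : ∀ A → IsHyperplane M (lift A) ⇔ IsHyperplane N A
  hyperplane-lift A = flat-lift A ×-⇔ corank-lift 1 A

  corank₂-lift : ∀ A → IsCorank2Flat M (lift A) ⇔ IsCorank2Flat N A
  corank₂-lift A = flat-lift A ×-⇔ corank-lift 2 A

  modular-lift : ∀ A₁ A₂ A₃ → IsModularTriple M (lift A₁) (lift A₂) (lift A₃) ⇔ IsModularTriple N A₁ A₂ A₃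
  modular-lift A₁ A₂ A₃ =
    hyperplane-lift A₁ ×-⇔ hyperplane-lift A₂ ×-⇔ hyperplane-lift A₃ ×-⇔
    intersection-corank₂ ×-⇔ meet A₁ A₂ ×-⇔ meet A₁ A₃ ×-⇔ meet A₂ A₃
    where
    lift-∩³ : lift A₁ ∩ lift A₂ ∩ lift A₃ ≡ lift (A₁ ∩ A₂ ∩ A₃)
    lift-∩³ = trans (cong (lift A₁ ∩_) (lift-∩ A₂ A₃)) (lift-∩ A₁ _)
    intersection-corank₂ : IsCorank2Flat M (lift A₁ ∩ lift A₂ ∩ lift A₃) ⇔ IsCorank2Flat N (A₁ ∩ A₂ ∩ A₃)
    intersection-corank₂ = mk⇔
      (to (corank₂-lift _) ∘ subst (IsCorank2Flat M) lift-∩³)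
      (subst (IsCorank2Flat M) (sym lift-∩³) ∘ from (corank₂-lift _))
    meet : ∀ A B → (lift A ∩ lift B ≡ lift A₁ ∩ lift A₂ ∩ lift A₃) ⇔ (A ∩ B ≡ A₁ ∩ A₂ ∩ A₃)
    meet A B = mk⇔
      (λ eq → lift-injective (trans (sym (lift-∩ A B)) (trans eq lift-∩³)))
      (λ eq → trans (lift-∩ A B) (trans (cong lift eq) (sym lift-∩³)))

module DirectSum {n₁ n₂ : ℕ} (M₁ : Matroid n₁) (M₂ : Matroid n₂) (M : Matroid (n₁ + n₂))
                 (ds : IsDirectSum M₁ M₂ M) where

  private
    r₁ : Subset n₁ → ℕ
    r₁ = Matroid.rank M₁
    r₂ : Subset n₂ → ℕ
    r₂ = Matroid.rank M₂
    r : Subset (n₁ + n₂) → ℕ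
    r = Matroid.rank M

  rank-++ : ∀ A B → r (A ++ B) ≡ r₁ A + r₂ B
  rank-++ A B = trans (ds (A ++ B)) (cong₂ _+_ (cong r₁ (take-++ A B)) (cong r₂ (drop-++ A B)))

  rank-⊤ : r ⊤ ≡ r₁ ⊤ + r₂ ⊤
  rank-⊤ = trans (cong r (⊤-++ n₁)) (rank-++ ⊤ ⊤)

  flat-++ : ∀ A B → IsFlat M (A ++ B) ⇔ (IsFlat M₁ A × IsFlat M₂ B)
  flat-++ A B = mk⇔
    (λ flat → (λ i i∉A → to (grows-↑ˡ i) (flat (i ↑ˡ n₂) (i∉A ∘ to (↑ˡ∈++⇔∈ A B i))))
            , (λ j j∉B → to (grows-↑ʳ j) (flat (n₁ ↑ʳ j) (j∉B ∘ to (↑ʳ∈++⇔∈ A B j)))))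
    (λ (flat₁ , flat₂) e e∉ → grows flat₁ flat₂ (splitView n₁ e) e∉)
    where
    grows-↑ˡ : ∀ i → r (A ++ B) < r ((A ++ B) ∪ ⁅ i ↑ˡ n₂ ⁆) ⇔ r₁ A < r₁ (A ∪ ⁅ i ⁆)
    grows-↑ˡ i = mk⇔
      (λ lt → +-cancelʳ-< (r₂ B) _ _ (subst₂ _<_ (rank-++ A B) eq lt))
      (λ lt → subst₂ _<_ (sym (rank-++ A B)) (sym eq) (+-monoˡ-< (r₂ B) lt))
      where
      eq : r ((A ++ B) ∪ ⁅ i ↑ˡ n₂ ⁆) ≡ r₁ (A ∪ ⁅ i ⁆) + r₂ B
      eq = trans (cong r (++-∪-⁅↑ˡ⁆ A B i)) (rank-++ _ B)
    grows-↑ʳ : ∀ j → r (A ++ B) < r ((A ++ B) ∪ ⁅ n₁ ↑ʳ j ⁆) ⇔ r₂ B < r₂ (B ∪ ⁅ j ⁆)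
    grows-↑ʳ j = mk⇔
      (λ lt → +-cancelˡ-< (r₁ A) _ _ (subst₂ _<_ (rank-++ A B) eq lt))
      (λ lt → subst₂ _<_ (sym (rank-++ A B)) (sym eq) (+-monoʳ-< (r₁ A) lt))
      where
      eq : r ((A ++ B) ∪ ⁅ n₁ ↑ʳ j ⁆) ≡ r₁ A + r₂ (B ∪ ⁅ j ⁆)
      eq = trans (cong r (++-∪-⁅↑ʳ⁆ A B j)) (rank-++ A _)
    grows : IsFlat M₁ A → IsFlat M₂ B → ∀ {e} → SplitView n₁ n₂ e →
            e ∉ A ++ B → r (A ++ B) < r ((A ++ B) ∪ ⁅ e ⁆)
    grows flat₁ _ (left i)  e∉ = from (grows-↑ˡ i) (flat₁ i (e∉ ∘ from (↑ˡ∈++⇔∈ A B i)))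
    grows _ flat₂ (right j) e∉ = from (grows-↑ʳ j) (flat₂ j (e∉ ∘ from (↑ʳ∈++⇔∈ A B j)))

  module Left = FlatEmbedding M₁ M (_++ ⊤) (r₂ ⊤) (++-injectiveˡ _ _)
    (λ A B → trans (zipWith-++ _∧_ A ⊤ B ⊤) (cong ((A ∩ B) ++_) (∩-identityˡ ⊤)))
    (sym (⊤-++ n₁)) (λ A → rank-++ A ⊤)
    (λ A → mk⇔ (proj₁ ∘ to (flat-++ A ⊤)) (λ flat → from (flat-++ A ⊤) (flat , ⊤-isFlat M₂)))

  module Right = FlatEmbedding M₂ M (⊤ {n₁} ++_) (r₁ ⊤) (++-injectiveʳ ⊤ ⊤)
    (λ A B → trans (zipWith-++ _∧_ ⊤ A ⊤ B) (cong (_++ (A ∩ B)) (∩-identityˡ ⊤)))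
    (sym (⊤-++ n₁)) (λ B → trans (rank-++ ⊤ B) (+-comm (r₁ ⊤) (r₂ B)))
    (λ B → mk⇔ (proj₂ ∘ to (flat-++ ⊤ B)) (λ flat → from (flat-++ ⊤ B) (⊤-isFlat M₁ , flat)))

  data HyperplaneSide : Subset (n₁ + n₂) → Set where
    left  : ∀ {A : Subset n₁} → IsHyperplane M₁ A → HyperplaneSide (A ++ ⊤)
    right : ∀ {B : Subset n₂} → IsHyperplane M₂ B → HyperplaneSide (⊤ ++ B)

  hyperplane-side : ∀ {H : Subset (n₁ + n₂)} → IsHyperplane M H → HyperplaneSide H
  hyperplane-side {H} hH = subst HyperplaneSide (take++drop≡id n₁ H)
    (side (take n₁ H) (drop n₁ H) (subst (IsHyperplane M) (sym (take++drop≡id n₁ H)) hH))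
    where
    side : ∀ A B → IsHyperplane M (A ++ B) → HyperplaneSide (A ++ B)
    side A B (flat , corank₁)
      with to (flat-++ A B) flat
         | suc[m+n]≡o+p-cases (Matroid.rank-mono M₁ ⊆⊤) (Matroid.rank-mono M₂ ⊆⊤)
             (trans (cong suc (sym (rank-++ A B))) (trans corank₁ rank-⊤))
    ... | flat₁ , flat₂ | inj₁ (corank₁₁ , full₂) =
      subst (HyperplaneSide ∘ (A ++_)) (sym (flat-of-full-rank≡⊤ M₂ flat₂ full₂)) (left (flat₁ , corank₁₁))
    ... | flat₁ , flat₂ | inj₂ (full₁ , corank₁₂) =
      subst (HyperplaneSide ∘ (_++ B)) (sym (flat-of-full-rank≡⊤ M₁ flat₁ full₁)) (right (flat₂ , corank₁₂))

  data ModularSide : Subset (n₁ + n₂) → Subset (n₁ + n₂) → Subset (n₁ + n₂) → Set where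
    left  : ∀ {A₁ A₂ A₃ : Subset n₁} → IsModularTriple M₁ A₁ A₂ A₃ →
            ModularSide (A₁ ++ ⊤) (A₂ ++ ⊤) (A₃ ++ ⊤)
    right : ∀ {B₁ B₂ B₃ : Subset n₂} → IsModularTriple M₂ B₁ B₂ B₃ →
            ModularSide (⊤ ++ B₁) (⊤ ++ B₂) (⊤ ++ B₃)

  -- All pairwise meets in a modular triple coincide, but only a same-side pair meets in a set
  -- containing E₂ (resp. E₁); so a modular triple never mixes sides.
  left-pair≢mixed-pair : ∀ {A A′ C : Subset n₁} {B : Subset n₂} → IsHyperplane M₂ B →
                         (A ++ ⊤) ∩ (A′ ++ ⊤) ≢ (C ++ ⊤) ∩ (⊤ ++ B)
  left-pair≢mixed-pair {A} {A′} {C} {B} hB eq = hyperplane≢⊤ M₂ hB (begin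
    B      ≡⟨ ∩-identityˡ B ⟨
    ⊤ ∩ B  ≡⟨ ++-injectiveʳ (A ∩ A′) (C ∩ ⊤)
                (trans (sym (zipWith-++ _∧_ A ⊤ A′ ⊤)) (trans eq (zipWith-++ _∧_ C ⊤ ⊤ B))) ⟨
    ⊤ ∩ ⊤  ≡⟨ ∩-identityˡ ⊤ ⟩
    ⊤      ∎)
    where open ≡-Reasoning

  right-pair≢mixed-pair : ∀ {B B′ C : Subset n₂} {A : Subset n₁} → IsHyperplane M₁ A →
                          (⊤ ++ B) ∩ (⊤ ++ B′) ≢ (A ++ ⊤) ∩ (⊤ ++ C)
  right-pair≢mixed-pair {B} {B′} {C} {A} hA eq = hyperplane≢⊤ M₁ hA (begin
    A      ≡⟨ ∩-identityʳ A ⟨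
    A ∩ ⊤  ≡⟨ ++-injectiveˡ (⊤ ∩ ⊤) (A ∩ ⊤)
                (trans (sym (zipWith-++ _∧_ ⊤ B ⊤ B′)) (trans eq (zipWith-++ _∧_ A ⊤ ⊤ C))) ⟨
    ⊤ ∩ ⊤  ≡⟨ ∩-identityˡ ⊤ ⟩
    ⊤      ∎)
    where open ≡-Reasoning

  modular-side : ∀ {H₁ H₂ H₃} → IsModularTriple M H₁ H₂ H₃ → ModularSide H₁ H₂ H₃
  modular-side mt@(h₁ , h₂ , h₃ , _ , p₁₂ , p₁₃ , p₂₃)
    with hyperplane-side h₁ | hyperplane-side h₂ | hyperplane-side h₃
  ... | left _   | left _   | left _   = left (to (Left.modular-lift _ _ _) mt)
  ... | right _  | right _  | right _  = right (to (Right.modular-lift _ _ _) mt)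
  ... | left _   | left _   | right h₃′ = ⊥-elim (left-pair≢mixed-pair h₃′ (trans p₁₂ (sym p₁₃)))
  ... | left _   | right h₂′ | left _   = ⊥-elim (left-pair≢mixed-pair h₂′ (trans p₁₃ (sym p₁₂)))
  ... | right h₁′ | left _   | left _   =
    ⊥-elim (left-pair≢mixed-pair h₁′ (trans p₂₃ (sym (trans (∩-comm _ _) p₁₂))))
  ... | left h₁′ | right _  | right _  = ⊥-elim (right-pair≢mixed-pair h₁′ (trans p₂₃ (sym p₁₂)))
  ... | right _  | left h₂′ | right _  =
    ⊥-elim (right-pair≢mixed-pair h₂′ (trans p₁₃ (sym (trans (∩-comm _ _) p₁₂))))
  ... | right _  | right _  | left h₃′ =
    ⊥-elim (right-pair≢mixed-pair h₃′ (trans p₁₂ (sym (trans (∩-comm _ _) p₁₃))))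

module PastureProperties (P : Pasture) where
  open Pasture P

  ·-zeroʳ : ∀ x → x · 0# ≡ 0#
  ·-zeroʳ x = trans (·-comm x 0#) (·-zero x)

  one≢0 : one ≢ 0#
  one≢0 one≡0 = ε≢0 (trans (sym (·-identity ε)) (trans (cong (_· ε) one≡0) (·-zero ε)))

  inverse≢0 : ∀ {x y} → x · y ≡ one → y ≢ 0#
  inverse≢0 {x} xy≡1 refl = one≢0 (trans (sym xy≡1) (·-zeroʳ x))

  ·-nonzero : ∀ {x y} → x ≢ 0# → y ≢ 0# → x · y ≢ 0#
  ·-nonzero {x} {y} x≢0 y≢0 xy≡0 with ·-inverse x x≢0
  ... | x⁻¹ , xx⁻¹≡1 = y≢0 (begin
    y               ≡⟨ ·-identity y ⟨
    one · y         ≡⟨ cong (_· y) (trans (sym xx⁻¹≡1) (·-comm x x⁻¹)) ⟩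
    (x⁻¹ · x) · y   ≡⟨ ·-assoc x⁻¹ x y ⟩
    x⁻¹ · (x · y)   ≡⟨ cong (x⁻¹ ·_) xy≡0 ⟩
    x⁻¹ · 0#        ≡⟨ ·-zeroʳ x⁻¹ ⟩
    0#              ∎)
    where open ≡-Reasoning

  ·-interchange : ∀ a b c d → (a · b) · (c · d) ≡ (a · c) · (b · d)
  ·-interchange a b c d = begin
    (a · b) · (c · d)   ≡⟨ ·-assoc a b (c · d) ⟩
    a · (b · (c · d))   ≡⟨ cong (a ·_) (·-assoc b c d) ⟨
    a · ((b · c) · d)   ≡⟨ cong (λ z → a · (z · d)) (·-comm b c) ⟩
    a · ((c · b) · d)   ≡⟨ cong (a ·_) (·-assoc c b d) ⟩
    a · (c · (b · d))   ≡⟨ ·-assoc a c (b · d) ⟨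
    (a · c) · (b · d)   ∎
    where open ≡-Reasoning

  Null-·-cong : ∀ c₁ c₂ c₃ {x₁ x₂ x₃ y₁ y₂ y₃} → x₁ ≡ y₁ → x₂ ≡ y₂ → x₃ ≡ y₃ →
                Null (c₁ · y₁) (c₂ · y₂) (c₃ · y₃) → Null (c₁ · x₁) (c₂ · x₂) (c₃ · x₃)
  Null-·-cong _ _ _ refl refl refl null = null

  Null-·-zeros : ∀ c₁ c₂ c₃ → Null (c₁ · 0#) (c₂ · 0#) (c₃ · 0#)
  Null-·-zeros c₁ c₂ c₃ rewrite ·-zeroʳ c₁ | ·-zeroʳ c₂ | ·-zeroʳ c₃ = from (Null-single 0#) refl

  -- junk value one where A fails
  inverseWhen : ∀ {A : Set} → Dec A → (x : Carrier) → (A → x ≢ 0#) → Carrier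
  inverseWhen (yes a) x x≢0 = proj₁ (·-inverse x (x≢0 a))
  inverseWhen (no _)  _ _   = one

  inverseWhen-inverse : ∀ {A : Set} (a? : Dec A) x x≢0 → A → x · inverseWhen a? x x≢0 ≡ one
  inverseWhen-inverse (yes a) x x≢0 _ = proj₂ (·-inverse x (x≢0 a))
  inverseWhen-inverse (no ¬a) x x≢0 a = ⊥-elim (¬a a)

  inverseWhen≢0 : ∀ {A : Set} (a? : Dec A) x x≢0 → inverseWhen a? x x≢0 ≢ 0#
  inverseWhen≢0 (yes a) x x≢0 = inverse≢0 (proj₂ (·-inverse x (x≢0 a)))
  inverseWhen≢0 (no _)  _ _   = one≢0

  zeros : ∀ {m} → Fin m → Carrier
  zeros _ = 0#

  ZeroSet : ∀ {m} → (Fin m → Carrier) → Subset m → Set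
  ZeroSet v A = ∀ e → (v e ≡ 0#) ⇔ e ∈ A

  zeros-ZeroSet : ∀ {m} → ZeroSet (zeros {m}) ⊤
  zeros-ZeroSet _ = mk⇔ (λ _ → ∈⊤) (λ _ → refl)

  ZeroSet-↑ˡ : ∀ {m n} {v : Fin (m + n) → Carrier} {A B} → ZeroSet v (A ++ B) → ZeroSet (v ∘ (_↑ˡ n)) A
  ZeroSet-↑ˡ {n = n} {A = A} {B} zv i = ↑ˡ∈++⇔∈ A B i ⇔-∘ zv (i ↑ˡ n)

  ZeroSet-↑ʳ : ∀ {m n} {v : Fin (m + n) → Carrier} {A B} → ZeroSet v (A ++ B) → ZeroSet (v ∘ (m ↑ʳ_)) B
  ZeroSet-↑ʳ {m} {A = A} {B} zv j = ↑ʳ∈++⇔∈ A B j ⇔-∘ zv (m ↑ʳ j)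

  ZeroSet-++ : ∀ {m n} {v : Fin m → Carrier} {w : Fin n → Carrier} {A B} →
               ZeroSet v A → ZeroSet w B → ZeroSet (v ++ᶠ w) (A ++ B)
  ZeroSet-++ {m} {n} {v} {w} {A} {B} zv zw e = on (splitView m e)
    where
    ≡0-cong : ∀ {x y} → x ≡ y → (x ≡ 0#) ⇔ (y ≡ 0#)
    ≡0-cong x≡y = mk⇔ (trans (sym x≡y)) (trans x≡y)
    on : ∀ {e} → SplitView m n e → ((v ++ᶠ w) e ≡ 0#) ⇔ e ∈ A ++ B
    on (left i)  = ⇔-sym (↑ˡ∈++⇔∈ A B i) ⇔-∘ (zv i ⇔-∘ ≡0-cong (lookupᶠ-++ˡ v w i))
    on (right j) = ⇔-sym (↑ʳ∈++⇔∈ A B j) ⇔-∘ (zw j ⇔-∘ ≡0-cong (lookupᶠ-++ʳ v w j))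

  restrict-++-zeros : ∀ {m n} {v : Fin (m + n) → Carrier} {A} → ZeroSet v (A ++ ⊤) →
                      ∀ e → ((v ∘ (_↑ˡ n)) ++ᶠ zeros) e ≡ v e
  restrict-++-zeros {m} {n} {v} {A} zv e = on (splitView m e)
    where
    on : ∀ {e} → SplitView m n e → ((v ∘ (_↑ˡ n)) ++ᶠ zeros) e ≡ v e
    on (left i)  = lookupᶠ-++ˡ (v ∘ (_↑ˡ n)) zeros i
    on (right j) = trans (lookupᶠ-++ʳ (v ∘ (_↑ˡ n)) zeros j)
                         (sym (from (zv (m ↑ʳ j)) (from (↑ʳ∈++⇔∈ A ⊤ j) ∈⊤)))

  zeros-++-restrict : ∀ {m n} {v : Fin (m + n) → Carrier} {B} → ZeroSet v (⊤ ++ B) →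
                      ∀ e → (zeros ++ᶠ (v ∘ (m ↑ʳ_))) e ≡ v e
  zeros-++-restrict {m} {n} {v} {B} zv e = on (splitView m e)
    where
    on : ∀ {e} → SplitView m n e → (zeros ++ᶠ (v ∘ (m ↑ʳ_))) e ≡ v e
    on (left i)  = trans (lookupᶠ-++ˡ (zeros {m}) (v ∘ (m ↑ʳ_)) i)
                         (sym (from (zv (i ↑ˡ n)) (from (↑ˡ∈++⇔∈ ⊤ B i) ∈⊤)))
    on (right j) = lookupᶠ-++ʳ (zeros {m}) (v ∘ (m ↑ʳ_)) j

  ++-zeros-scaled : ∀ {m n} {v v′ d : Fin m → Carrier} {d′ : Fin n → Carrier} {c} →
    (∀ i → v′ i ≡ (c · d i) · v i) →
    ∀ e → (v′ ++ᶠ zeros) e ≡ (c · (d ++ᶠ d′) e) · (v ++ᶠ zeros) e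
  ++-zeros-scaled {m} {n} {v} {v′} {d} {d′} {c} scaled e = on (splitView m e)
    where
    on : ∀ {e} → SplitView m n e → (v′ ++ᶠ zeros) e ≡ (c · (d ++ᶠ d′) e) · (v ++ᶠ zeros) e
    on (left i) = trans (lookupᶠ-++ˡ v′ zeros i) (trans (scaled i)
      (sym (cong₂ (λ x y → (c · x) · y) (lookupᶠ-++ˡ d d′ i) (lookupᶠ-++ˡ v zeros i))))
    on (right j) = trans (lookupᶠ-++ʳ v′ zeros j)
      (sym (trans (cong (_ ·_) (lookupᶠ-++ʳ v zeros j)) (·-zeroʳ _)))

  zeros-++-scaled : ∀ {m n} {w w′ d′ : Fin n → Carrier} {d : Fin m → Carrier} {c} →
    (∀ j → w′ j ≡ (c · d′ j) · w j) →
    ∀ e → (zeros ++ᶠ w′) e ≡ (c · (d ++ᶠ d′) e) · (zeros ++ᶠ w) e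
  zeros-++-scaled {m} {n} {w} {w′} {d′} {d} {c} scaled e = on (splitView m e)
    where
    on : ∀ {e} → SplitView m n e → (zeros ++ᶠ w′) e ≡ (c · (d ++ᶠ d′) e) · (zeros ++ᶠ w) e
    on (left i) = trans (lookupᶠ-++ˡ (zeros {m}) w′ i)
      (sym (trans (cong (_ ·_) (lookupᶠ-++ˡ (zeros {m}) w i)) (·-zeroʳ _)))
    on (right j) = trans (lookupᶠ-++ʳ (zeros {m}) w′ j) (trans (scaled j)
      (sym (cong₂ (λ x y → (c · x) · y) (lookupᶠ-++ʳ d d′ j) (lookupᶠ-++ʳ (zeros {m}) w j))))

  ++ᶠ-nonzero : ∀ {m n} {v : Fin m → Carrier} {w : Fin n → Carrier} →
                (∀ i → v i ≢ 0#) → (∀ j → w j ≢ 0#) → ∀ e → (v ++ᶠ w) e ≢ 0#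
  ++ᶠ-nonzero {m} {v = v} {w} v≢0 w≢0 e = [_,_] {C = λ s → [ v , w ]′ s ≢ 0#} v≢0 w≢0 (splitAt m e)

  LinearlyDependent : ∀ {A : Set} → (A → Carrier) → (A → Carrier) → (A → Carrier) → Set
  LinearlyDependent v₁ v₂ v₃ =
    Σ Carrier λ c₁ → Σ Carrier λ c₂ → Σ Carrier λ c₃ →
      ¬ (c₁ ≡ 0# × c₂ ≡ 0# × c₃ ≡ 0#) × (∀ e → Null (c₁ · v₁ e) (c₂ · v₂ e) (c₃ · v₃ e))

  LinearlyDependent-cong : ∀ {A : Set} {v₁ v₂ v₃ w₁ w₂ w₃ : A → Carrier} →
    v₁ ≡ w₁ → v₂ ≡ w₂ → v₃ ≡ w₃ →
    LinearlyDependent v₁ v₂ v₃ → LinearlyDependent w₁ w₂ w₃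
  LinearlyDependent-cong refl refl refl dependent = dependent

  LinearlyDependent-∘ : ∀ {A B : Set} {v₁ v₂ v₃ : A → Carrier} (ι : B → A) →
    LinearlyDependent v₁ v₂ v₃ → LinearlyDependent (v₁ ∘ ι) (v₂ ∘ ι) (v₃ ∘ ι)
  LinearlyDependent-∘ ι (c₁ , c₂ , c₃ , nontrivial , null) = c₁ , c₂ , c₃ , nontrivial , null ∘ ι

  LinearlyDependent-++-zeros : ∀ {m n} {v₁ v₂ v₃ : Fin m → Carrier} → LinearlyDependent v₁ v₂ v₃ →
    LinearlyDependent (v₁ ++ᶠ zeros {n}) (v₂ ++ᶠ zeros) (v₃ ++ᶠ zeros)
  LinearlyDependent-++-zeros {m} {n} {v₁} {v₂} {v₃} (c₁ , c₂ , c₃ , nontrivial , null) =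
    c₁ , c₂ , c₃ , nontrivial , λ e → on (splitView m e)
    where
    on : ∀ {e} → SplitView m n e →
         Null (c₁ · (v₁ ++ᶠ zeros) e) (c₂ · (v₂ ++ᶠ zeros) e) (c₃ · (v₃ ++ᶠ zeros) e)
    on (left i)  = Null-·-cong c₁ c₂ c₃
                     (lookupᶠ-++ˡ v₁ zeros i) (lookupᶠ-++ˡ v₂ zeros i) (lookupᶠ-++ˡ v₃ zeros i) (null i)
    on (right j) = Null-·-cong c₁ c₂ c₃
                     (lookupᶠ-++ʳ v₁ zeros j) (lookupᶠ-++ʳ v₂ zeros j) (lookupᶠ-++ʳ v₃ zeros j)
                     (Null-·-zeros c₁ c₂ c₃)

  zeros-++-LinearlyDependent : ∀ {m n} {w₁ w₂ w₃ : Fin n → Carrier} → LinearlyDependent w₁ w₂ w₃ →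
    LinearlyDependent (zeros {m} ++ᶠ w₁) (zeros ++ᶠ w₂) (zeros ++ᶠ w₃)
  zeros-++-LinearlyDependent {m} {n} {w₁} {w₂} {w₃} (c₁ , c₂ , c₃ , nontrivial , null) =
    c₁ , c₂ , c₃ , nontrivial , λ e → on (splitView m e)
    where
    on : ∀ {e} → SplitView m n e →
         Null (c₁ · (zeros ++ᶠ w₁) e) (c₂ · (zeros ++ᶠ w₂) e) (c₃ · (zeros ++ᶠ w₃) e)
    on (left i)  = Null-·-cong c₁ c₂ c₃
                     (lookupᶠ-++ˡ (zeros {m}) w₁ i) (lookupᶠ-++ˡ (zeros {m}) w₂ i) (lookupᶠ-++ˡ (zeros {m}) w₃ i)
                     (Null-·-zeros c₁ c₂ c₃)
    on (right j) = Null-·-cong c₁ c₂ c₃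
                     (lookupᶠ-++ʳ (zeros {m}) w₁ j) (lookupᶠ-++ʳ (zeros {m}) w₂ j) (lookupᶠ-++ʳ (zeros {m}) w₃ j)
                     (null j)

Hom-nonzero : ∀ {P Q} (g : Hom P Q) {x} → x ≢ Pasture.0# P → Hom.fun g x ≢ Pasture.0# Q
Hom-nonzero {P} {Q} g {x} x≢0 gx≡0 with Pasture.·-inverse P x x≢0
... | y , xy≡1 = PastureProperties.one≢0 Q (begin
  Q.one                 ≡⟨ Hom.pres-one g ⟨
  g.fun P.one           ≡⟨ cong g.fun xy≡1 ⟨
  g.fun (x P.· y)       ≡⟨ Hom.pres-· g x y ⟩
  g.fun x Q.· g.fun y   ≡⟨ cong (Q._· g.fun y) gx≡0 ⟩
  Q.0# Q.· g.fun y      ≡⟨ Q.·-zero _ ⟩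
  Q.0#                  ∎)
  where
  open ≡-Reasoning
  module P = Pasture P
  module Q = Pasture Q
  module g = Hom g

Hom-++ᶠ : ∀ {P Q} (g : Hom P Q) {m n} {v : Fin m → Pasture.Carrier P} {w : Fin n → Pasture.Carrier P} {v′ w′} →
          (∀ i → Hom.fun g (v i) ≡ v′ i) → (∀ j → Hom.fun g (w j) ≡ w′ j) →
          ∀ e → Hom.fun g ((v ++ᶠ w) e) ≡ (v′ ++ᶠ w′) e
Hom-++ᶠ g {m} gv≡v′ gw≡w′ e = trans ([,]-∘ (Hom.fun g) (splitAt m e)) ([,]-cong gv≡v′ gw≡w′ (splitAt m e))

module RescalingProperties {k : ℕ} (N : Matroid k) (P : Pasture) where
  open Pasture P
  open PastureProperties P

  equal-on-hyperplanes⇒Rescaling : ∀ {f f′ : Family k P} →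
    (∀ H → IsHyperplane N H → ∀ e → f H e ≡ f′ H e) → Rescaling N P f f′
  equal-on-hyperplanes⇒Rescaling {f} eq =
    (λ _ → one) , (λ _ → one) , (λ _ _ → one≢0) , (λ _ → one≢0) ,
    λ H hH e → trans (sym (eq H hH e))
                     (sym (trans (cong (_· f H e) (·-identity one)) (·-identity (f H e))))

  Rescaling-refl : ∀ {f} → Rescaling N P f f
  Rescaling-refl = equal-on-hyperplanes⇒Rescaling (λ _ _ _ → refl)

  Rescaling-trans : ∀ {f g h} → Rescaling N P f g → Rescaling N P g h → Rescaling N P f h
  Rescaling-trans {f} {g} {h} (cH , cE , cH≢0 , cE≢0 , g≡cf) (dH , dE , dH≢0 , dE≢0 , h≡dg) =
    (λ H → dH H · cH H) , (λ e → dE e · cE e) ,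
    (λ H hH → ·-nonzero (dH≢0 H hH) (cH≢0 H hH)) , (λ e → ·-nonzero (dE≢0 e) (cE≢0 e)) ,
    λ H hH e → begin
      h H e                                     ≡⟨ h≡dg H hH e ⟩
      (dH H · dE e) · g H e                     ≡⟨ cong ((dH H · dE e) ·_) (g≡cf H hH e) ⟩
      (dH H · dE e) · ((cH H · cE e) · f H e)   ≡⟨ ·-assoc _ _ _ ⟨
      ((dH H · dE e) · (cH H · cE e)) · f H e   ≡⟨ cong (_· f H e) (·-interchange _ _ _ _) ⟩
      ((dH H · cH H) · (dE e · cE e)) · f H e   ∎
    where open ≡-Reasoning

  -- cH is known to be nonzero only on hyperplanes, so it is inverted only there (via isHyperplane?).
  Rescaling-sym : ∀ {f g} → Rescaling N P f g → Rescaling N P g f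
  Rescaling-sym {f} {g} (cH , cE , cH≢0 , cE≢0 , g≡cf) =
    cH⁻¹ , cE⁻¹ , (λ H _ → inverseWhen≢0 (isHyperplane? N H) (cH H) (cH≢0 H)) ,
    (λ e → inverse≢0 (cE·cE⁻¹≡1 e)) ,
    λ H hH e → begin
      f H e                                          ≡⟨ ·-identity (f H e) ⟨
      one · f H e                                    ≡⟨ cong (_· f H e) (·-identity one) ⟨
      (one · one) · f H e                            ≡⟨ cong (_· f H e) (cong₂ _·_ (cH·cH⁻¹≡1 H hH) (cE·cE⁻¹≡1 e)) ⟨
      ((cH H · cH⁻¹ H) · (cE e · cE⁻¹ e)) · f H e    ≡⟨ cong (_· f H e) (·-interchange _ _ _ _) ⟩
      ((cH H · cE e) · (cH⁻¹ H · cE⁻¹ e)) · f H e    ≡⟨ cong (_· f H e) (·-comm _ _) ⟩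
      ((cH⁻¹ H · cE⁻¹ e) · (cH H · cE e)) · f H e    ≡⟨ ·-assoc _ _ _ ⟩
      (cH⁻¹ H · cE⁻¹ e) · ((cH H · cE e) · f H e)    ≡⟨ cong ((cH⁻¹ H · cE⁻¹ e) ·_) (g≡cf H hH e) ⟨
      (cH⁻¹ H · cE⁻¹ e) · g H e                      ∎
    where
    open ≡-Reasoning
    cH⁻¹ : Subset k → Carrier
    cH⁻¹ H = inverseWhen (isHyperplane? N H) (cH H) (cH≢0 H)
    cE⁻¹ : Fin k → Carrier
    cE⁻¹ e = proj₁ (·-inverse (cE e) (cE≢0 e))
    cH·cH⁻¹≡1 : ∀ H → IsHyperplane N H → cH H · cH⁻¹ H ≡ one
    cH·cH⁻¹≡1 H = inverseWhen-inverse (isHyperplane? N H) (cH H) (cH≢0 H)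
    cE·cE⁻¹≡1 : ∀ e → cE e · cE⁻¹ e ≡ one
    cE·cE⁻¹≡1 e = proj₂ (·-inverse (cE e) (cE≢0 e))

  rescalingSetoid : Setoid 0ℓ 0ℓ
  rescalingSetoid = record
    { Carrier = Family k P
    ; _≈_ = Rescaling N P
    ; isEquivalence = record { refl = Rescaling-refl ; sym = Rescaling-sym ; trans = Rescaling-trans }
    }

Rescaling-push : ∀ {k} (N : Matroid k) {P Q} (g : Hom P Q) {f f′ : Family k P} →
  Rescaling N P f f′ → Rescaling N Q (pushFamily g f) (pushFamily g f′)
Rescaling-push N {Q = Q} g {f} (cH , cE , cH≢0 , cE≢0 , f′≡cf) =
  (Hom.fun g ∘ cH) , (Hom.fun g ∘ cE) ,
  (λ H hH → Hom-nonzero g (cH≢0 H hH)) , (λ e → Hom-nonzero g (cE≢0 e)) ,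
  λ H hH e → trans (cong (Hom.fun g) (f′≡cf H hH e))
                   (trans (Hom.pres-· g _ _) (cong (λ c → Pasture._·_ Q c (Hom.fun g (f H e))) (Hom.pres-· g _ _)))

module Gluing {n₁ n₂ : ℕ} (M₁ : Matroid n₁) (M₂ : Matroid n₂) (M : Matroid (n₁ + n₂))
              (ds : IsDirectSum M₁ M₂ M) where
  open DirectSum M₁ M₂ M ds

  -- Hyperplanes A ++ ⊤ of M are told apart from hyperplanes ⊤ ++ B by their second half.
  bySide : {X : Set} → (Subset n₁ → X) → (Subset n₂ → X) → Subset (n₁ + n₂) → X
  bySide g₁ g₂ H = if does (is⊤? (drop n₁ H)) then g₁ (take n₁ H) else g₂ (drop n₁ H)

  bySide-left : ∀ {X : Set} (g₁ : Subset n₁ → X) g₂ A → bySide g₁ g₂ (A ++ ⊤) ≡ g₁ A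
  bySide-left g₁ g₂ A =
    trans (cong (λ b → if b then g₁ (take n₁ (A ++ ⊤)) else g₂ (drop n₁ (A ++ ⊤)))
                (dec-true (is⊤? _) (drop-++ A ⊤)))
          (cong g₁ (take-++ A ⊤))

  bySide-right : ∀ {X : Set} (g₁ : Subset n₁ → X) g₂ {B : Subset n₂} → B ≢ ⊤ →
                 bySide g₁ g₂ (⊤ ++ B) ≡ g₂ B
  bySide-right g₁ g₂ {B} B≢⊤ =
    trans (cong (λ b → if b then g₁ (take n₁ (⊤ ++ B)) else g₂ (drop n₁ (⊤ ++ B)))
                (dec-false (is⊤? _) (B≢⊤ ∘ trans (sym (drop-++ (⊤ {n₁}) B)))))
          (cong g₂ (drop-++ (⊤ {n₁}) B))

  module _ (P : Pasture) where
    open Pasture P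
    open PastureProperties P
    open RescalingProperties

    restrictˡ : Family (n₁ + n₂) P → Family n₁ P
    restrictˡ f A = f (A ++ ⊤) ∘ (_↑ˡ n₂)

    restrictʳ : Family (n₁ + n₂) P → Family n₂ P
    restrictʳ f B = f (⊤ ++ B) ∘ (n₁ ↑ʳ_)

    glueFamily : Family n₁ P → Family n₂ P → Family (n₁ + n₂) P
    glueFamily f₁ f₂ = bySide (λ A → f₁ A ++ᶠ zeros) (λ B → zeros ++ᶠ f₂ B)

    glue-left : ∀ f₁ f₂ A → glueFamily f₁ f₂ (A ++ ⊤) ≡ f₁ A ++ᶠ zeros
    glue-left f₁ f₂ = bySide-left (λ A → f₁ A ++ᶠ zeros) (λ B → zeros ++ᶠ f₂ B)

    glue-right : ∀ f₁ f₂ {B} → IsHyperplane M₂ B → glueFamily f₁ f₂ (⊤ ++ B) ≡ zeros ++ᶠ f₂ B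
    glue-right f₁ f₂ hB = bySide-right (λ A → f₁ A ++ᶠ zeros) (λ B → zeros ++ᶠ f₂ B) (hyperplane≢⊤ M₂ hB)

    restrictRepˡ : Rep M P → Rep M₁ P
    restrictRepˡ ρ = record
      { f        = restrictˡ (Rep.f ρ)
      ; zero-iff = λ A hA → ZeroSet-↑ˡ (Rep.zero-iff ρ _ (from (Left.hyperplane-lift A) hA))
      ; modular  = λ A₁ A₂ A₃ mt →
          LinearlyDependent-∘ (_↑ˡ n₂) (Rep.modular ρ _ _ _ (from (Left.modular-lift A₁ A₂ A₃) mt))
      }

    restrictRepʳ : Rep M P → Rep M₂ P
    restrictRepʳ ρ = record
      { f        = restrictʳ (Rep.f ρ)
      ; zero-iff = λ B hB → ZeroSet-↑ʳ (Rep.zero-iff ρ _ (from (Right.hyperplane-lift B) hB))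
      ; modular  = λ B₁ B₂ B₃ mt →
          LinearlyDependent-∘ (n₁ ↑ʳ_) (Rep.modular ρ _ _ _ (from (Right.modular-lift B₁ B₂ B₃) mt))
      }

    glueRep : Rep M₁ P → Rep M₂ P → Rep M P
    glueRep ρ₁ ρ₂ = record { f = glueFamily f₁ f₂ ; zero-iff = zero-iff ; modular = modular }
      where
      f₁ : Family n₁ P
      f₁ = Rep.f ρ₁
      f₂ : Family n₂ P
      f₂ = Rep.f ρ₂
      zero-iff : ∀ H → IsHyperplane M H → ZeroSet (glueFamily f₁ f₂ H) H
      zero-iff H hH with hyperplane-side hH
      ... | left {A} hA  = subst (λ v → ZeroSet v (A ++ ⊤)) (sym (glue-left f₁ f₂ A))
                             (ZeroSet-++ (Rep.zero-iff ρ₁ A hA) zeros-ZeroSet)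
      ... | right {B} hB = subst (λ v → ZeroSet v (⊤ ++ B)) (sym (glue-right f₁ f₂ hB))
                             (ZeroSet-++ zeros-ZeroSet (Rep.zero-iff ρ₂ B hB))
      modular : ∀ H₁ H₂ H₃ → IsModularTriple M H₁ H₂ H₃ →
                LinearlyDependent (glueFamily f₁ f₂ H₁) (glueFamily f₁ f₂ H₂) (glueFamily f₁ f₂ H₃)
      modular _ _ _ mt with modular-side mt
      ... | left  mt₁ = LinearlyDependent-cong
              (sym (glue-left f₁ f₂ _)) (sym (glue-left f₁ f₂ _)) (sym (glue-left f₁ f₂ _))
              (LinearlyDependent-++-zeros (Rep.modular ρ₁ _ _ _ mt₁))
      ... | right mt₂@(hB₁ , hB₂ , hB₃ , _) = LinearlyDependent-cong
              (sym (glue-right f₁ f₂ hB₁)) (sym (glue-right f₁ f₂ hB₂)) (sym (glue-right f₁ f₂ hB₃))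
              (zeros-++-LinearlyDependent (Rep.modular ρ₂ _ _ _ mt₂))

    restrictˡ-Rescaling : ∀ {f f′} → Rescaling M P f f′ → Rescaling M₁ P (restrictˡ f) (restrictˡ f′)
    restrictˡ-Rescaling (cH , cE , cH≢0 , cE≢0 , scaled) =
      (cH ∘ (_++ ⊤)) , (cE ∘ (_↑ˡ n₂)) , (λ A hA → cH≢0 _ (from (Left.hyperplane-lift A) hA)) ,
      (cE≢0 ∘ (_↑ˡ n₂)) , (λ A hA i → scaled _ (from (Left.hyperplane-lift A) hA) (i ↑ˡ n₂))

    restrictʳ-Rescaling : ∀ {f f′} → Rescaling M P f f′ → Rescaling M₂ P (restrictʳ f) (restrictʳ f′)
    restrictʳ-Rescaling (cH , cE , cH≢0 , cE≢0 , scaled) =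
      (cH ∘ (⊤ ++_)) , (cE ∘ (n₁ ↑ʳ_)) , (λ B hB → cH≢0 _ (from (Right.hyperplane-lift B) hB)) ,
      (cE≢0 ∘ (n₁ ↑ʳ_)) , (λ B hB j → scaled _ (from (Right.hyperplane-lift B) hB) (n₁ ↑ʳ j))

    glue-Rescaling : ∀ {f₁ f₁′ f₂ f₂′} → Rescaling M₁ P f₁ f₁′ → Rescaling M₂ P f₂ f₂′ →
                     Rescaling M P (glueFamily f₁ f₂) (glueFamily f₁′ f₂′)
    glue-Rescaling {f₁} {f₁′} {f₂} {f₂′}
                   (cH₁ , cE₁ , cH₁≢0 , cE₁≢0 , scaled₁) (cH₂ , cE₂ , cH₂≢0 , cE₂≢0 , scaled₂) =
      bySide cH₁ cH₂ , cE₁ ++ᶠ cE₂ , cH≢0 , ++ᶠ-nonzero cE₁≢0 cE₂≢0 , scaled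
      where
      cH≢0 : ∀ H → IsHyperplane M H → bySide cH₁ cH₂ H ≢ 0#
      cH≢0 H hH with hyperplane-side hH
      ... | left {A} hA  = subst (_≢ 0#) (sym (bySide-left cH₁ cH₂ A)) (cH₁≢0 A hA)
      ... | right {B} hB = subst (_≢ 0#) (sym (bySide-right cH₁ cH₂ (hyperplane≢⊤ M₂ hB))) (cH₂≢0 B hB)
      scaled : ∀ H → IsHyperplane M H → ∀ e →
               glueFamily f₁′ f₂′ H e ≡ (bySide cH₁ cH₂ H · (cE₁ ++ᶠ cE₂) e) · glueFamily f₁ f₂ H e
      scaled H hH e with hyperplane-side hH
      ... | left {A} hA = begin
        glueFamily f₁′ f₂′ (A ++ ⊤) e                          ≡⟨ cong-app (glue-left f₁′ f₂′ A) e ⟩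
        (f₁′ A ++ᶠ zeros) e                                    ≡⟨ ++-zeros-scaled (scaled₁ A hA) e ⟩
        (cH₁ A · (cE₁ ++ᶠ cE₂) e) · (f₁ A ++ᶠ zeros) e         ≡⟨ cong₂ (λ c v → (c · _) · v)
                                                                    (bySide-left cH₁ cH₂ A) (cong-app (glue-left f₁ f₂ A) e) ⟨
        (bySide cH₁ cH₂ (A ++ ⊤) · (cE₁ ++ᶠ cE₂) e) · glueFamily f₁ f₂ (A ++ ⊤) e ∎
        where open ≡-Reasoning
      ... | right {B} hB = begin
        glueFamily f₁′ f₂′ (⊤ ++ B) e                          ≡⟨ cong-app (glue-right f₁′ f₂′ hB) e ⟩
        (zeros ++ᶠ f₂′ B) e                                    ≡⟨ zeros-++-scaled (scaled₂ B hB) e ⟩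
        (cH₂ B · (cE₁ ++ᶠ cE₂) e) · (zeros ++ᶠ f₂ B) e         ≡⟨ cong₂ (λ c v → (c · _) · v)
                                                                    (bySide-right cH₁ cH₂ (hyperplane≢⊤ M₂ hB))
                                                                    (cong-app (glue-right f₁ f₂ hB) e) ⟨
        (bySide cH₁ cH₂ (⊤ ++ B) · (cE₁ ++ᶠ cE₂) e) · glueFamily f₁ f₂ (⊤ ++ B) e ∎
        where open ≡-Reasoning

    restrictˡ-glue : ∀ f₁ f₂ → Rescaling M₁ P (restrictˡ (glueFamily f₁ f₂)) f₁
    restrictˡ-glue f₁ f₂ = equal-on-hyperplanes⇒Rescaling M₁ P λ A _ i →
      trans (cong-app (glue-left f₁ f₂ A) (i ↑ˡ n₂)) (lookupᶠ-++ˡ (f₁ A) zeros i)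

    restrictʳ-glue : ∀ f₁ f₂ → Rescaling M₂ P (restrictʳ (glueFamily f₁ f₂)) f₂
    restrictʳ-glue f₁ f₂ = equal-on-hyperplanes⇒Rescaling M₂ P λ B hB j →
      trans (cong-app (glue-right f₁ f₂ hB) (n₁ ↑ʳ j)) (lookupᶠ-++ʳ (zeros {n₁}) (f₂ B) j)

    glue-restrict : ∀ (ρ : Rep M P) → Rescaling M P (glueFamily (restrictˡ (Rep.f ρ)) (restrictʳ (Rep.f ρ))) (Rep.f ρ)
    glue-restrict ρ = equal-on-hyperplanes⇒Rescaling M P agree
      where
      agree : ∀ H → IsHyperplane M H → ∀ e →
              glueFamily (restrictˡ (Rep.f ρ)) (restrictʳ (Rep.f ρ)) H e ≡ Rep.f ρ H e
      agree H hH e with hyperplane-side hH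
      ... | left {A} _   = trans (cong-app (glue-left (restrictˡ (Rep.f ρ)) (restrictʳ (Rep.f ρ)) A) e)
                                   (restrict-++-zeros {n₁} {A = A} (Rep.zero-iff ρ _ hH) e)
      ... | right {B} hB = trans (cong-app (glue-right (restrictˡ (Rep.f ρ)) (restrictʳ (Rep.f ρ)) hB) e)
                                   (zeros-++-restrict {n₁} {B = B} (Rep.zero-iff ρ _ hH) e)

  push-glue : ∀ {P Q} (g : Hom P Q) f₁ f₂ H e →
    pushFamily g (glueFamily P f₁ f₂) H e ≡ glueFamily Q (pushFamily g f₁) (pushFamily g f₂) H e
  push-glue {P} {Q} g f₁ f₂ H e = begin
    Hom.fun g ((if side then v₁ else v₂) e)                ≡⟨ if-float (λ v → Hom.fun g (v e)) side {v₁} {v₂} ⟩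
    (if side then Hom.fun g (v₁ e) else Hom.fun g (v₂ e))  ≡⟨ cong₂ (if side then_else_)
                                                                (Hom-++ᶠ g {n₁} (λ _ → refl) (λ _ → Hom.pres-0 g) e)
                                                                (Hom-++ᶠ g {n₁} (λ _ → Hom.pres-0 g) (λ _ → refl) e) ⟩
    (if side then w₁ e else w₂ e)                          ≡⟨ if-float (λ v → v e) side {w₁} {w₂} ⟨
    (if side then w₁ else w₂) e                            ∎
    where
    open ≡-Reasoning
    side : Bool
    side = does (is⊤? (drop n₁ H))
    v₁ v₂ : Fin (n₁ + n₂) → Pasture.Carrier P
    v₁ = f₁ (take n₁ H) ++ᶠ PastureProperties.zeros P
    v₂ = PastureProperties.zeros P ++ᶠ f₂ (drop n₁ H)
    w₁ w₂ : Fin (n₁ + n₂) → Pasture.Carrier Q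
    w₁ = pushFamily g f₁ (take n₁ H) ++ᶠ PastureProperties.zeros Q
    w₂ = PastureProperties.zeros Q ++ᶠ pushFamily g f₂ (drop n₁ H)

module Foundation {k : ℕ} {N : Matroid k} {F : Pasture} (IF : IsFoundation N F) where
  open IsFoundation IF
  open RescalingProperties

  classify : ∀ {P} → Rep N P → Hom F P
  classify {P} ρ = proj₁ (Φ-surj P ρ)

  Φ-classify : ∀ {P} (ρ : Rep N P) → Rescaling N P (Rep.f (Φ P (classify ρ))) (Rep.f ρ)
  Φ-classify {P} ρ = proj₂ (Φ-surj P ρ)

  push-Φ : ∀ {P Q} (g : Hom P Q) {h : Hom F P} {h′ : Hom F Q} → (g ∘H h) ≈H h′ →
           Rescaling N Q (pushFamily g (Rep.f (Φ P h))) (Rep.f (Φ Q h′))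
  push-Φ {P} {Q} g {h} g∘h≈h′ = Rescaling-trans N Q (Rescaling-sym N Q (Φ-nat P Q g h)) (Φ-resp Q _ _ g∘h≈h′)

module DirectSumFoundation {n₁ n₂ : ℕ} (M₁ : Matroid n₁) (M₂ : Matroid n₂) (M : Matroid (n₁ + n₂))
  (ds : IsDirectSum M₁ M₂ M) {F F₁ F₂ T : Pasture}
  (IF : IsFoundation M F) (IF₁ : IsFoundation M₁ F₁) (IF₂ : IsFoundation M₂ F₂)
  {ι₁ : Hom F₁ T} {ι₂ : Hom F₂ T} (cp : IsCoproduct ι₁ ι₂) where

  open Gluing M₁ M₂ M ds
  open RescalingProperties
  open Foundation
  open IsCoproduct cp
  open Rep using (f)
  private
    module Φ  = IsFoundation IF
    module Φ₁ = IsFoundation IF₁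
    module Φ₂ = IsFoundation IF₂

  σ : Rep M F
  σ = Φ.Φ F (idHom F)

  ρ₁ : Rep M₁ T
  ρ₁ = Φ₁.Φ T ι₁

  ρ₂ : Rep M₂ T
  ρ₂ = Φ₂.Φ T ι₂

  toTensor : Hom F T
  toTensor = classify IF (glueRep T ρ₁ ρ₂)

  fromF₁ : Hom F₁ F
  fromF₁ = classify IF₁ (restrictRepˡ F σ)

  fromF₂ : Hom F₂ F
  fromF₂ = classify IF₂ (restrictRepʳ F σ)

  fromTensor : Hom T F
  fromTensor = copair fromF₁ fromF₂

  from∘to≈id : (fromTensor ∘H toTensor) ≈H idHom F
  from∘to≈id = Φ.Φ-inj F _ _ (begin
    f (Φ.Φ F (fromTensor ∘H toTensor))
      ≈⟨ Φ.Φ-nat T F fromTensor toTensor ⟩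
    pushFamily fromTensor (f (Φ.Φ T toTensor))
      ≈⟨ Rescaling-push M fromTensor (Φ-classify IF (glueRep T ρ₁ ρ₂)) ⟩
    pushFamily fromTensor (glueFamily T (f ρ₁) (f ρ₂))
      ≈⟨ equal-on-hyperplanes⇒Rescaling M F (λ H _ → push-glue fromTensor (f ρ₁) (f ρ₂) H) ⟩
    glueFamily F (pushFamily fromTensor (f ρ₁)) (pushFamily fromTensor (f ρ₂))
      ≈⟨ glue-Rescaling F fromTensor-ρ₁ fromTensor-ρ₂ ⟩
    glueFamily F (restrictˡ F (f σ)) (restrictʳ F (f σ))
      ≈⟨ glue-restrict F σ ⟩
    f σ ∎)
    where
    open SetoidReasoning (rescalingSetoid M F)
    fromTensor-ρ₁ : Rescaling M₁ F (pushFamily fromTensor (f ρ₁)) (restrictˡ F (f σ))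
    fromTensor-ρ₁ = Rescaling-trans M₁ F (push-Φ IF₁ fromTensor (copair-ι₁ fromF₁ fromF₂))
                                         (Φ-classify IF₁ (restrictRepˡ F σ))
    fromTensor-ρ₂ : Rescaling M₂ F (pushFamily fromTensor (f ρ₂)) (restrictʳ F (f σ))
    fromTensor-ρ₂ = Rescaling-trans M₂ F (push-Φ IF₂ fromTensor (copair-ι₂ fromF₁ fromF₂))
                                         (Φ-classify IF₂ (restrictRepʳ F σ))

  to∘from≈id : (toTensor ∘H fromTensor) ≈H idHom T
  to∘from≈id = copair-unique (toTensor ∘H fromTensor) (idHom T) (Φ₁.Φ-inj T _ _ on-ι₁) (Φ₂.Φ-inj T _ _ on-ι₂)
    where
    toTensor-σ : Rescaling M T (pushFamily toTensor (f σ)) (glueFamily T (f ρ₁) (f ρ₂))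
    toTensor-σ = Rescaling-trans M T (push-Φ IF toTensor (λ _ → refl)) (Φ-classify IF (glueRep T ρ₁ ρ₂))
    on-ι₁ : Rescaling M₁ T (f (Φ₁.Φ T ((toTensor ∘H fromTensor) ∘H ι₁))) (f (Φ₁.Φ T (idHom T ∘H ι₁)))
    on-ι₁ = begin
      f (Φ₁.Φ T ((toTensor ∘H fromTensor) ∘H ι₁))
        ≈⟨ Φ₁.Φ-resp T _ _ (cong (Hom.fun toTensor) ∘ copair-ι₁ fromF₁ fromF₂) ⟩
      f (Φ₁.Φ T (toTensor ∘H fromF₁))
        ≈⟨ Φ₁.Φ-nat F T toTensor fromF₁ ⟩
      pushFamily toTensor (f (Φ₁.Φ F fromF₁))
        ≈⟨ Rescaling-push M₁ toTensor (Φ-classify IF₁ (restrictRepˡ F σ)) ⟩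
      restrictˡ T (pushFamily toTensor (f σ))
        ≈⟨ restrictˡ-Rescaling T toTensor-σ ⟩
      restrictˡ T (glueFamily T (f ρ₁) (f ρ₂))
        ≈⟨ restrictˡ-glue T (f ρ₁) (f ρ₂) ⟩
      f ρ₁
        ≈⟨ Φ₁.Φ-resp T _ _ (λ _ → refl) ⟩
      f (Φ₁.Φ T (idHom T ∘H ι₁)) ∎
      where open SetoidReasoning (rescalingSetoid M₁ T)
    on-ι₂ : Rescaling M₂ T (f (Φ₂.Φ T ((toTensor ∘H fromTensor) ∘H ι₂))) (f (Φ₂.Φ T (idHom T ∘H ι₂)))
    on-ι₂ = begin
      f (Φ₂.Φ T ((toTensor ∘H fromTensor) ∘H ι₂))
        ≈⟨ Φ₂.Φ-resp T _ _ (cong (Hom.fun toTensor) ∘ copair-ι₂ fromF₁ fromF₂) ⟩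
      f (Φ₂.Φ T (toTensor ∘H fromF₂))
        ≈⟨ Φ₂.Φ-nat F T toTensor fromF₂ ⟩
      pushFamily toTensor (f (Φ₂.Φ F fromF₂))
        ≈⟨ Rescaling-push M₂ toTensor (Φ-classify IF₂ (restrictRepʳ F σ)) ⟩
      restrictʳ T (pushFamily toTensor (f σ))
        ≈⟨ restrictʳ-Rescaling T toTensor-σ ⟩
      restrictʳ T (glueFamily T (f ρ₁) (f ρ₂))
        ≈⟨ restrictʳ-glue T (f ρ₁) (f ρ₂) ⟩
      f ρ₂
        ≈⟨ Φ₂.Φ-resp T _ _ (λ _ → refl) ⟩
      f (Φ₂.Φ T (idHom T ∘H ι₂)) ∎
      where open SetoidReasoning (rescalingSetoid M₂ T)

corollaryA : ∀ {n₁ n₂ : ℕ} (M₁ : Matroid n₁) (M₂ : Matroid n₂) (M : Matroid (n₁ + n₂)) →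
    IsDirectSum M₁ M₂ M →
    (F F₁ F₂ T : Pasture) →
    IsFoundation M F → IsFoundation M₁ F₁ → IsFoundation M₂ F₂ →
    (ι₁ : Hom F₁ T) (ι₂ : Hom F₂ T) → IsCoproduct ι₁ ι₂ →
    F ≅ T
corollaryA M₁ M₂ M ds F F₁ F₂ T IF IF₁ IF₂ ι₁ ι₂ cp = record
  { to = toTensor ; from = fromTensor ; from∘to = from∘to≈id ; to∘from = to∘from≈id }
  where open DirectSumFoundation M₁ M₂ M ds IF IF₁ IF₂ cp
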